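{- For all integers $r,s\ge 2$, $c_H(K_r\vee \overline{K_s})=\lfloor r/2\rfloor+1$.
   Context: $K_r$ is the complete graph on $r$ vertices, $\overline{K_s}$ the edgeless graph on $s$ vertices, and $\vee$ denotes the join (disjoint union plus all edges between the two parts). Hyperopic Cops and Robbers on a finite connected simple graph $G$: one player controls $k$ cops, the other a single robber. The cops first choose starting vertices (several cops may share a vertex), then the robber chooses a starting vertex; afterwards, in each round, each cop moves to an adjacent vertex or stays put, and then the robber moves to an adjacent vertex or stays put. The robber always knows the cops' positions. The robber is invisible to the cops exactly when the robber's vertex is adjacent to the vertex of every cop (a robber on the same vertex as a cop is visible); otherwise the cops see the robber's position. The cops win if after finitely many rounds some cop occupies the robber's vertex, and the cops' strategy must guarantee this with certainty (no chance allowed). The hyperopic cop number $c_H(G)$ is the minimum $k$ for which $k$ cops have a winning strategy. -}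

module Defs where

open import Data.Nat using (ℕ; zero; suc; _<_)
open import Data.Fin using (Fin)
open import Data.Fin.Properties using (all?; _≟_)
open import Data.Sum using (_⊎_; inj₁; inj₂)
open import Data.Product using (Σ; ∃; _×_; _,_)
open import Data.Maybe using (Maybe; just; nothing)
open import Data.List using (List; []; _∷_)
open import Data.Unit using (⊤; tt)
open import Data.Empty using (⊥)
open import Relation.Nullary using (¬_; Dec; yes; no; does)
open import Relation.Nullary.Decidable using (¬?)
open import Relation.Binary.PropositionalEquality using (_≡_)
open import Data.Bool using (if_then_else_)

record Graph : Set₁ where
  field
    V     : Set
    Adj   : V → V → Set
    adj?  : (u v : V) → Dec (Adj u v)
    sym   : ∀ {u v} → Adj u v → Adj v u
    irrefl : ∀ {u} → ¬ Adj u u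

open Graph public

complete : ℕ → Graph
complete r = record
  { V = Fin r
  ; Adj = λ i j → ¬ i ≡ j
  ; adj? = λ i j → ¬? (i ≟ j)
  ; sym = λ ne eq → ne (Relation.Binary.PropositionalEquality.sym eq)
  ; irrefl = λ ne → ne Relation.Binary.PropositionalEquality.refl
  }

edgeless : ℕ → Graph
edgeless s = record
  { V = Fin s
  ; Adj = λ _ _ → ⊥
  ; adj? = λ _ _ → no (λ ())
  ; sym = λ ()
  ; irrefl = λ ()
  }

join : Graph → Graph → Graph
join G H = record
  { V = V G ⊎ V H
  ; Adj = J
  ; adj? = J?
  ; sym = λ {u} {v} → Js {u} {v}
  ; irrefl = λ {u} → Ji {u}
  }
  where
  J : V G ⊎ V H → V G ⊎ V H → Set
  J (inj₁ a) (inj₁ b) = Adj G a b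
  J (inj₁ a) (inj₂ b) = ⊤
  J (inj₂ a) (inj₁ b) = ⊤
  J (inj₂ a) (inj₂ b) = Adj H a b
  J? : ∀ u v → Dec (J u v)
  J? (inj₁ a) (inj₁ b) = adj? G a b
  J? (inj₁ a) (inj₂ b) = yes tt
  J? (inj₂ a) (inj₁ b) = yes tt
  J? (inj₂ a) (inj₂ b) = adj? H a b
  Js : ∀ {u v} → J u v → J v u
  Js {inj₁ a} {inj₁ b} e = sym G e
  Js {inj₁ a} {inj₂ b} e = tt
  Js {inj₂ a} {inj₁ b} e = tt
  Js {inj₂ a} {inj₂ b} e = sym H e
  Ji : ∀ {u} → ¬ J u u
  Ji {inj₁ a} = irrefl G
  Ji {inj₂ a} = irrefl H

module Game (G : Graph) (k : ℕ) where

  Step : V G → V G → Set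
  Step u v = u ≡ v ⊎ Adj G u v

  Config : Set
  Config = Fin k → V G

  Invisible : Config → V G → Set
  Invisible c v = ∀ i → Adj G v (c i)

  invisible? : (c : Config) (v : V G) → Dec (Invisible c v)
  invisible? c v = all? (λ i → adj? G v (c i))

  observe : Config → V G → Maybe (V G)
  observe c v = if does (invisible? c v) then nothing else just v

  -- A (deterministic) cop strategy: an initial placement, and a rule giving the
  -- next configuration from the cops' entire observation history (most recent
  -- observation first) and their current configuration; every cop makes a legal move.
  record CopStrategy : Set where
    field
      start : Config
      next  : List (Maybe (V G)) → Config → Config
      legal : ∀ h c i → Step (c i) (next h c i)

  -- A robber trajectory: r t is the robber's vertex after his t-th move
  -- (r 0 = his starting vertex); every move is legal.
  LegalRobber : (ℕ → V G) → Set
  LegalRobber r = ∀ t → Step (r t) (r (suc t))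

  module Play (σ : CopStrategy) (r : ℕ → V G) where
    open CopStrategy σ
    -- cops (t) : configuration after the cops' t-th move (cops 0 = start);
    -- hist t   : observations available to the cops when choosing cops (suc t).
    -- Order of play: cops 0, r 0, cops 1, r 1, cops 2, r 2, ...
    mutual
      cops : ℕ → Config
      cops zero    = start
      cops (suc t) = next (hist t) (cops t)

      hist : ℕ → List (Maybe (V G))
      hist zero    = observe start (r zero) ∷ []
      hist (suc t) = observe (cops (suc t)) (r (suc t))
                   ∷ observe (cops (suc t)) (r t)
                   ∷ hist t

    -- capture in round t: a cop is on the robber's vertex, either after the
    -- robber's t-th move or after the cops' following move
    CaughtAt : ℕ → Set
    CaughtAt t = ∃ λ i → cops t i ≡ r t ⊎ cops (suc t) i ≡ r t

  -- The cop strategy wins if against every robber behaviour the robber is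
  -- caught after finitely many rounds.  (The cops are deterministic, so a
  -- robber strategy is the same as an adaptively chosen legal trajectory.)
  Winning : CopStrategy → Set
  Winning σ = ∀ r → LegalRobber r → ∃ λ t → Play.CaughtAt σ r t

  CopsWin : Set
  CopsWin = ∃ λ σ → Winning σ

HyperopicCopNumber : Graph → ℕ → Set
HyperopicCopNumber G m = Game.CopsWin G m × (∀ k → k < m → ¬ Game.CopsWin G k)

-- With ⌊r/2⌋ + 1 cops the robber is caught in the first round.  One cop stands in the
-- independent set, the others on a set A of ⌊r/2⌋ clique vertices.  A robber in the
-- independent set is not adjacent to that cop, so he is seen and a clique cop steps onto
-- him; a robber on the clique outside A is invisible, and the cops answer "invisible" by
-- moving onto ⌊r/2⌋ + 1 clique vertices that cover the rest of the clique.
--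
-- Against k ≤ r/2 cops the robber stays invisible forever.  Each round he predicts the
-- cops' answer to "invisible": if some clique vertex is occupied neither now nor after
-- that answer he goes there, and otherwise all 2k ≤ r cop positions exhaust the clique
-- and he hides in the other part.  Being invisible, he makes the prediction come true.

module Submission where

open import Defs hiding (sym)
open import Data.Nat using (ℕ; _≤_; _+_; ⌊_/2⌋)
open import Data.Nat as ℕ using (zero; suc; z≤n; s≤s; _<_)
open import Data.Nat.Properties as ℕ using ()
open import Data.Fin as Fin using (Fin; zero; suc; toℕ; fromℕ<; inject≤; splitAt; _↑ˡ_; _↑ʳ_; punchOut)
open import Data.Fin.Properties as Fin using (any?; all?; ¬∀⟶∃¬)
open import Data.Sum using (_⊎_; inj₁; inj₂; [_,_]′)
open import Data.Sum.Properties using (inj₁-injective; ≡-dec)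
open import Data.Product using (∃; _,_; proj₁; proj₂; uncurry)
open import Data.Maybe using (Maybe; just; nothing)
open import Data.List using (List; []; _∷_)
open import Data.Unit using (tt)
open import Data.Bool using (if_then_else_)
open import Data.Empty using (⊥-elim)
open import Function using (_∘_)
open import Relation.Nullary using (¬_; Dec; yes; no; _⊎-dec_)
open import Relation.Nullary.Decidable using (map′; dec-true; dec-false)
open import Relation.Binary.Definitions using (DecidableEquality)
open import Relation.Binary.PropositionalEquality

≟-inj₁ : ∀ {A B : Set} → DecidableEquality A → (v : A ⊎ B) (x : A) → Dec (v ≡ inj₁ x)
≟-inj₁ _≟_ (inj₁ a) x = map′ (cong inj₁) inj₁-injective (a ≟ x)
≟-inj₁ _≟_ (inj₂ b) x = no λ ()

module _ {r n : ℕ} (r≤n : r ≤ n) (x₀ : Fin r) where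

  retract : Fin n → Fin r
  retract j with toℕ j ℕ.<? r
  ... | yes j<r = fromℕ< j<r
  ... | no _ = x₀

  retract-inject≤ : ∀ x → retract (inject≤ x r≤n) ≡ x
  retract-inject≤ x with toℕ (inject≤ x r≤n) ℕ.<? r
  ... | yes j<r = Fin.toℕ-injective (trans (Fin.toℕ-fromℕ< j<r) (Fin.toℕ-inject≤ x r≤n))
  ... | no j≮r = ⊥-elim (j≮r (subst (_< r) (sym (Fin.toℕ-inject≤ x r≤n)) (Fin.toℕ<n x)))

Covers : ∀ {r a b} → (Fin a → Fin r) → (Fin b → Fin r) → Set
Covers f g = ∀ x → (∃ λ i → f i ≡ x) ⊎ (∃ λ j → g j ≡ x)

split-cover : ∀ {r a b} → r ≤ a + b → Fin r →
              ∃ λ (f : Fin a → Fin r) → ∃ λ (g : Fin b → Fin r) → Covers f g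
split-cover {r} {a} {b} r≤a+b x₀ = enum ∘ (_↑ˡ b) , enum ∘ (a ↑ʳ_) , covers
  where
  enum = retract r≤a+b x₀
  covers : Covers (enum ∘ (_↑ˡ b)) (enum ∘ (a ↑ʳ_))
  covers x with splitAt a (inject≤ x r≤a+b) | Fin.join-splitAt a b (inject≤ x r≤a+b)
  ... | inj₁ i | i↑ˡ≡ = inj₁ (i , trans (cong enum i↑ˡ≡) (retract-inject≤ r≤a+b x₀ x))
  ... | inj₂ j | ↑ʳj≡ = inj₂ (j , trans (cong enum ↑ʳj≡) (retract-inject≤ r≤a+b x₀ x))

-- Choosing a preimage of every x injects Fin r into Fin n with the point j removed.
onto-inj₁⇒no-inj₂ : ∀ {n r} {B : Set} (d : Fin n → Fin r ⊎ B) → n ≤ r →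
                    (∀ x → ∃ λ j → d j ≡ inj₁ x) → ∀ j y → d j ≢ inj₂ y
onto-inj₁⇒no-inj₂ {suc n} d n<r onto j y dj≡y =
  ℕ.<⇒≱ n<r (Fin.injective⇒≤ {f = λ x → punchOut (j≢g x)} punchOut∘g-injective)
  where
  g = proj₁ ∘ onto
  g-injective : ∀ {x₁ x₂} → g x₁ ≡ g x₂ → x₁ ≡ x₂
  g-injective {x₁} {x₂} eq =
    inj₁-injective (trans (sym (proj₂ (onto x₁))) (trans (cong d eq) (proj₂ (onto x₂))))
  j≢g : ∀ x → j ≢ g x
  j≢g x j≡gx with trans (sym dj≡y) (trans (cong d j≡gx) (proj₂ (onto x)))
  ... | ()
  punchOut∘g-injective : ∀ {x₁ x₂} → punchOut (j≢g x₁) ≡ punchOut (j≢g x₂) → x₁ ≡ x₂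
  punchOut∘g-injective = g-injective ∘ Fin.punchOut-injective (j≢g _) (j≢g _)

module Observation (G : Graph) (k : ℕ) where
  open Game G k

  observe-invisible : ∀ c v → Invisible c v → observe c v ≡ nothing
  observe-invisible c v inv = cong (if_then nothing else just v) (dec-true (invisible? c v) inv)

  observe-visible : ∀ c v → ¬ Invisible c v → observe c v ≡ just v
  observe-visible c v ¬inv = cong (if_then nothing else just v) (dec-false (invisible? c v) ¬inv)

module Approach (G : Graph) (_≟_ : DecidableEquality (V G)) where
  open Game G 0  -- Step does not depend on the number of cops

  step? : ∀ u v → Dec (Step u v)
  step? u v = (u ≟ v) ⊎-dec adj? G u v

  approach : V G → V G → V G
  approach u v with step? u v
  ... | yes _ = v
  ... | no _ = u

  approach-legal : ∀ u v → Step u (approach u v)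
  approach-legal u v with step? u v
  ... | yes u→v = u→v
  ... | no _ = inj₁ refl

  approach-reaches : ∀ u v → Step u v → approach u v ≡ v
  approach-reaches u v u→v with step? u v
  ... | yes _ = refl
  ... | no ¬u→v = ⊥-elim (¬u→v u→v)

module JoinComplete (r : ℕ) (H : Graph) (k : ℕ) where
  open Game (join (complete r) H) k

  step-to-clique : ∀ u x → Step u (inj₁ x)
  step-to-clique (inj₁ y) x with y Fin.≟ x
  ... | yes y≡x = inj₁ (cong inj₁ y≡x)
  ... | no y≢x = inj₂ y≢x
  step-to-clique (inj₂ y) x = inj₂ tt

  invisible-at-clique : ∀ c x → (∀ i → c i ≢ inj₁ x) → Invisible c (inj₁ x)
  invisible-at-clique c x free i with c i | free i
  ... | inj₁ y | y≢x = λ x≡y → y≢x (cong inj₁ (sym x≡y))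
  ... | inj₂ y | _ = tt

  invisible-off-clique : ∀ c y → (∀ i z → c i ≢ inj₂ z) → Invisible c (inj₂ y)
  invisible-off-clique c y onClique i with c i | onClique i
  ... | inj₁ z | _ = tt
  ... | inj₂ z | z∉ = ⊥-elim (z∉ z refl)

module CopsStrategy {r s m : ℕ} (y₀ : Fin s) (i₁ : Fin m)
                    (left : Fin m → Fin r) (right : Fin (suc m) → Fin r) (covers : Covers left right) where
  open Game (join (complete r) (edgeless s)) (suc m)
  open JoinComplete r (edgeless s) (suc m)
  open Observation (join (complete r) (edgeless s)) (suc m)
  open Approach (join (complete r) (edgeless s)) (≡-dec Fin._≟_ Fin._≟_)

  start : Config
  start zero = inj₂ y₀
  start (suc i) = inj₁ (left i)

  next : List (Maybe (V (join (complete r) (edgeless s)))) → Config → Config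
  next (just v ∷ _) c i = approach (c i) v
  next (nothing ∷ _) c i = inj₁ (right i)
  next [] c i = c i

  legal : ∀ h c i → Step (c i) (next h c i)
  legal (just v ∷ _) c i = approach-legal (c i) v
  legal (nothing ∷ _) c i = step-to-clique (c i) (right i)
  legal [] c i = inj₁ refl

  strategy : CopStrategy
  strategy = record { start = start ; next = next ; legal = legal }

  invisible-off-left : ∀ x → ¬ (∃ λ i → left i ≡ x) → Invisible start (inj₁ x)
  invisible-off-left x ¬left = invisible-at-clique start x free
    where
    free : ∀ i → start i ≢ inj₁ x
    free zero ()
    free (suc i) eq = ¬left (i , inj₁-injective eq)

  reacts-to : ∀ v {o} → observe start v ≡ o →
              ∀ i → next (observe start v ∷ []) start i ≡ next (o ∷ []) start i
  reacts-to v eq i = cong (λ o → next (o ∷ []) start i) eq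

  captures-at-once : ∀ v → ∃ λ i → start i ≡ v ⊎ next (observe start v ∷ []) start i ≡ v
  captures-at-once (inj₂ y) = suc i₁ , inj₂ (trans
    (reacts-to (inj₂ y) (observe-visible start (inj₂ y) (λ inv → inv zero)) (suc i₁))
    (approach-reaches (inj₁ (left i₁)) (inj₂ y) (inj₂ tt)))
  captures-at-once (inj₁ x) with any? (λ i → left i Fin.≟ x)
  ... | yes (i , left-i≡x) = suc i , inj₁ (cong inj₁ left-i≡x)
  ... | no ¬left with covers x
  ...   | inj₁ hit = ⊥-elim (¬left hit)
  ...   | inj₂ (i , right-i≡x) = i , inj₂ (trans
    (reacts-to (inj₁ x) (observe-invisible start (inj₁ x) (invisible-off-left x ¬left)) i)
    (cong inj₁ right-i≡x))

  winning : Winning strategy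
  winning R _ = zero , captures-at-once (R zero)

join-complete-edgeless-copsWin : ∀ {r s m} → r ≤ m + suc m → Fin r → Fin s → Fin m →
                                 Game.CopsWin (join (complete r) (edgeless s)) (suc m)
join-complete-edgeless-copsWin r≤2m+1 x₀ y₀ i₁ with split-cover r≤2m+1 x₀
... | left , right , covers = strategy , winning
  where open CopsStrategy y₀ i₁ left right covers

module RobberStrategy {r k : ℕ} (H : Graph) (h₀ : V H) (k+k≤r : k + k ≤ r) where
  open Game (join (complete r) H) k
  open JoinComplete r H k
  open Observation (join (complete r) H) k

  V′ : Set
  V′ = Fin r ⊎ V H

  positions : Config → Config → Fin (k + k) → V′
  positions c c′ = [ c , c′ ]′ ∘ splitAt k

  positions-now : ∀ c c′ i → positions c c′ (i ↑ˡ k) ≡ c i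
  positions-now c c′ i = cong [ c , c′ ]′ (Fin.splitAt-↑ˡ k i k)

  positions-next : ∀ c c′ i → positions c c′ (k ↑ʳ i) ≡ c′ i
  positions-next c c′ i = cong [ c , c′ ]′ (Fin.splitAt-↑ʳ k k i)

  Covered : Config → Config → Fin r → Set
  Covered c c′ x = ∃ λ j → positions c c′ j ≡ inj₁ x

  covered? : ∀ c c′ x → Dec (Covered c c′ x)
  covered? c c′ x = any? λ j → ≟-inj₁ Fin._≟_ (positions c c′ j) x

  anchor : V′ → V H
  anchor (inj₁ _) = h₀
  anchor (inj₂ y) = y

  step-to-anchor : ∀ u → Step u (inj₂ (anchor u))
  step-to-anchor (inj₁ _) = inj₂ tt
  step-to-anchor (inj₂ _) = inj₁ refl

  record Escape (c c′ : Config) (u v : V′) : Set where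
    field
      free-now  : ∀ i → c i ≢ v
      free-next : ∀ i → c′ i ≢ v
      hidden    : Invisible c v
      reachable : Step u v

  -- Either some clique vertex is covered by neither configuration, or all 2k ≤ r
  -- cop positions lie on the clique and the robber hides in H.
  escape : ∀ c c′ u → ∃ (Escape c c′ u)
  escape c c′ u with all? (covered? c c′)
  ... | yes all-covered = inj₂ (anchor u) , record
    { free-now  = λ i → off-clique (i ↑ˡ k) _ ∘ trans (positions-now c c′ i)
    ; free-next = λ i → off-clique (k ↑ʳ i) _ ∘ trans (positions-next c c′ i)
    ; hidden    = invisible-off-clique c _ λ i y → off-clique (i ↑ˡ k) y ∘ trans (positions-now c c′ i)
    ; reachable = step-to-anchor u
    }
    where off-clique = onto-inj₁⇒no-inj₂ (positions c c′) k+k≤r all-covered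
  ... | no ¬all-covered with ¬∀⟶∃¬ r _ (covered? c c′) ¬all-covered
  ...   | x , uncovered = inj₁ x , record
    { free-now  = free-now
    ; free-next = λ i → uncovered ∘ (k ↑ʳ i ,_) ∘ trans (positions-next c c′ i)
    ; hidden    = invisible-at-clique c x free-now
    ; reachable = step-to-clique u x
    }
    where
    free-now : ∀ i → c i ≢ inj₁ x
    free-now i = uncovered ∘ (i ↑ˡ k ,_) ∘ trans (positions-now c c′ i)

  module Against (σ : CopStrategy) where
    open CopStrategy σ

    -- The play against the robber R, rebuilt alongside R: L t is the cops' history
    -- without the observation of R t, and prev 0 is a dummy.
    mutual
      C : ℕ → Config
      C zero = start
      C (suc t) = next (observe (C t) (R t) ∷ L t) (C t)

      L : ℕ → List (Maybe V′)
      L zero = []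
      L (suc t) = observe (C (suc t)) (R t) ∷ observe (C t) (R t) ∷ L t

      prev : ℕ → V′
      prev zero = inj₂ h₀
      prev (suc t) = R t

      R : ℕ → V′
      R t = proj₁ (escape (C t) (next (nothing ∷ L t) (C t)) (prev t))

    escaped : ∀ t → Escape (C t) (next (nothing ∷ L t) (C t)) (prev t) (R t)
    escaped t = proj₂ (escape (C t) (next (nothing ∷ L t) (C t)) (prev t))

    mutual
      cops≡C : ∀ t → Play.cops σ R t ≡ C t
      cops≡C zero = refl
      cops≡C (suc t) = cong₂ next (hist≡ t) (cops≡C t)

      hist≡ : ∀ t → Play.hist σ R t ≡ observe (C t) (R t) ∷ L t
      hist≡ zero = refl
      hist≡ (suc t) = cong₂ (λ c h → observe c (R (suc t)) ∷ observe c (R t) ∷ h)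
                            (cops≡C (suc t)) (hist≡ t)

    C-suc≡blind-move : ∀ t → C (suc t) ≡ next (nothing ∷ L t) (C t)
    C-suc≡blind-move t =
      cong (λ o → next (o ∷ L t) (C t)) (observe-invisible (C t) (R t) (Escape.hidden (escaped t)))

    R-legal : LegalRobber R
    R-legal t = Escape.reachable (escaped (suc t))

    never-caught : ∀ t → ¬ Play.CaughtAt σ R t
    never-caught t (i , inj₁ caught) =
      Escape.free-now (escaped t) i (trans (sym (cong (λ c → c i) (cops≡C t))) caught)
    never-caught t (i , inj₂ caught) =
      Escape.free-next (escaped t) i
        (trans (sym (cong (λ c → c i) (trans (cops≡C (suc t)) (C-suc≡blind-move t)))) caught)

    ¬winning : ¬ Winning σ
    ¬winning wins = uncurry never-caught (wins R R-legal)

  ¬copsWin : ¬ CopsWin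
  ¬copsWin (σ , wins) = Against.¬winning σ wins

join-complete-¬copsWin : ∀ {r k} (H : Graph) → V H → k + k ≤ r → ¬ Game.CopsWin (join (complete r) H) k
join-complete-¬copsWin H h₀ k+k≤r = RobberStrategy.¬copsWin H h₀ k+k≤r

⌊n/2⌋+⌊n/2⌋≤n : ∀ n → ⌊ n /2⌋ + ⌊ n /2⌋ ≤ n
⌊n/2⌋+⌊n/2⌋≤n n = ℕ.≤-trans (ℕ.+-monoʳ-≤ ⌊ n /2⌋ (ℕ.⌊n/2⌋≤⌈n/2⌉ n)) (ℕ.≤-reflexive (ℕ.⌊n/2⌋+⌈n/2⌉≡n n))

n≤⌊n/2⌋+suc⌊n/2⌋ : ∀ n → n ≤ ⌊ n /2⌋ + suc ⌊ n /2⌋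
n≤⌊n/2⌋+suc⌊n/2⌋ n = ℕ.≤-trans (ℕ.≤-reflexive (sym (ℕ.⌊n/2⌋+⌈n/2⌉≡n n)))
  (ℕ.+-monoʳ-≤ ⌊ n /2⌋ (ℕ.⌊n/2⌋-mono (ℕ.n≤1+n (suc n))))

mainTheorem20 : ∀ (r s : ℕ) → 2 ≤ r → 2 ≤ s →
    HyperopicCopNumber (join (complete r) (edgeless s)) (⌊ r /2⌋ + 1)
mainTheorem20 r@(suc (suc _)) s@(suc _) (s≤s (s≤s z≤n)) _ = enough , fewer-lose
  where
  enough : Game.CopsWin (join (complete r) (edgeless s)) (⌊ r /2⌋ + 1)
  enough = subst (Game.CopsWin (join (complete r) (edgeless s))) (ℕ.+-comm 1 ⌊ r /2⌋)
    (join-complete-edgeless-copsWin (n≤⌊n/2⌋+suc⌊n/2⌋ r) zero zero zero)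
  fewer-lose : ∀ k → k < ⌊ r /2⌋ + 1 → ¬ Game.CopsWin (join (complete r) (edgeless s)) k
  fewer-lose k k<m+1 = join-complete-¬copsWin (edgeless s) zero
    (ℕ.≤-trans (ℕ.+-mono-≤ k≤m k≤m) (⌊n/2⌋+⌊n/2⌋≤n r))
    where
    k≤m : k ≤ ⌊ r /2⌋
    k≤m = ℕ.m<1+n⇒m≤n (subst (k <_) (ℕ.+-comm ⌊ r /2⌋ 1) k<m+1)
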